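{- Let $J$ be the $n\times n$ all-ones matrix and $I$ the identity, let $M=J-I$ in $M(n,1)$, and for each derangement $\sigma$ let $M_\sigma=J-I-P_\sigma$. Let $\{\sigma\}$ be a set of representatives of the conjugacy classes of derangements in $S_n$, and let $c_\sigma$ be the number of elements in the conjugacy class of $\sigma$. Then $$v(M)=\sum_\sigma c_\sigma\, v(M_\sigma).$$ Additionally, $v(J)=n!\cdot v(J-I)$, and $v(J)$ equals the number of Latin squares of size $n$.
   Context: $M(n,1)$ is the set of $n\times n$ matrices with entries in $\{0,1\}$ whose row and column sums all equal a common value, partially ordered entrywise; it has minimum $\hat0$ (the zero matrix) and maximum $J$, and $N$ covers $M$ iff $N=M+P_\sigma$ for some permutation matrix $P_\sigma$. The path number $v(M)$ is the number of maximal chains from $\hat 0$ to $M$ in $M(n,1)$, i.e. the number of ordered sequences of permutation matrices whose sum is $M$. A derangement is a permutation without fixed points. A Latin square of size $n$ is an $n\times n$ array with entries in $\{1,\dots,n\}$ in which each value occurs exactly once in each row and each column. -}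

module Defs where

open import Data.Nat using (ℕ; zero; suc; _∸_; _≟_)
open import Data.Bool using (if_then_else_)
open import Data.Fin using (Fin) renaming (_≟_ to _≟ᶠ_)
open import Data.Fin.Properties using (all?)
open import Data.Vec using (Vec; []; _∷_; lookup; tabulate)
import Data.Vec as Vec
open import Data.List using (List; []; _∷_; [_]; map; concatMap; filter; length; allFin)
open import Data.List.Relation.Unary.Any using (Any; any?)
open import Data.Product using (_×_)
open import Relation.Nullary using (Dec; does; ¬_)
open import Relation.Nullary.Decidable using (_→-dec_; _×-dec_; ¬?)
open import Relation.Binary.PropositionalEquality using (_≡_; _≢_)

vecs : ∀ {A : Set} → List A → (k : ℕ) → List (Vec A k)
vecs xs zero    = [ [] ]
vecs xs (suc k) = concatMap (λ x → map (x ∷_) (vecs xs k)) xs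

count : ∀ {A : Set} {P : A → Set} → ((a : A) → Dec (P a)) → List A → ℕ
count P? xs = length (filter P? xs)

Mat : ℕ → Set
Mat n = Fin n → Fin n → ℕ

δ : ∀ {n} → Fin n → Fin n → ℕ
δ i j = if does (i ≟ᶠ j) then 1 else 0

J : ∀ {n} → Mat n
J i j = 1

I : ∀ {n} → Mat n
I = δ

_⊕_ : ∀ {n} → Mat n → Mat n → Mat n
(A ⊕ B) i j = A i j Data.Nat.+ B i j

_⊖_ : ∀ {n} → Mat n → Mat n → Mat n
(A ⊖ B) i j = A i j ∸ B i j

zeroMat : ∀ {n} → Mat n
zeroMat i j = 0

_≐_ : ∀ {n} → Mat n → Mat n → Set
A ≐ B = ∀ i j → A i j ≡ B i j

_≐?_ : ∀ {n} (A B : Mat n) → Dec (A ≐ B)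
A ≐? B = all? (λ i → all? (λ j → A i j ≟ B i j))

-- common line sum (sum of the first row; 0 for the empty 0×0 matrix).
-- For M in M(n,1) this is the length of every maximal chain 0̂ → M.
lineSum : ∀ {n} → Mat n → ℕ
lineSum {zero}  M = 0
lineSum {suc n} M = Vec.sum (tabulate (M Fin.zero))
  where import Data.Fin as Fin

IsPerm : ∀ {n} → Vec (Fin n) n → Set
IsPerm σ = ∀ i j → lookup σ i ≡ lookup σ j → i ≡ j

isPerm? : ∀ {n} (σ : Vec (Fin n) n) → Dec (IsPerm σ)
isPerm? σ = all? (λ i → all? (λ j → (lookup σ i ≟ᶠ lookup σ j) →-dec (i ≟ᶠ j)))

perms : (n : ℕ) → List (Vec (Fin n) n)
perms n = filter isPerm? (vecs (allFin n) n)

IsDerangement : ∀ {n} → Vec (Fin n) n → Set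
IsDerangement σ = ∀ i → lookup σ i ≢ i

P : ∀ {n} → Vec (Fin n) n → Mat n
P σ i j = δ (lookup σ i) j

sumP : ∀ {n k} → Vec (Vec (Fin n) n) k → Mat n
sumP []       = zeroMat
sumP (σ ∷ ps) = P σ ⊕ sumP ps

-- path number v(M): number of ordered sequences of permutation matrices
-- (equivalently of permutations, σ ↦ P_σ being injective) whose sum is M,
-- i.e. the number of maximal chains 0̂ → M in M(n,1)
v : ∀ {n} → Mat n → ℕ
v {n} M = count (λ ps → sumP ps ≐? M) (vecs (perms n) (lineSum M))

-- conjugacy in S_n: τ = π σ π⁻¹ for some permutation π, i.e. τ ∘ π = π ∘ σ
Conj : ∀ {n} → Vec (Fin n) n → Vec (Fin n) n → Set
Conj {n} σ τ = Any (λ π → ∀ i → lookup τ (lookup π i) ≡ lookup π (lookup σ i)) (perms n)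

conj? : ∀ {n} (σ τ : Vec (Fin n) n) → Dec (Conj σ τ)
conj? σ τ = any? (λ π → all? (λ i → lookup τ (lookup π i) ≟ᶠ lookup π (lookup σ i))) _

classSize : ∀ {n} → Vec (Fin n) n → ℕ
classSize {n} σ = count (conj? σ) (perms n)

Mσ : ∀ {n} → Vec (Fin n) n → Mat n
Mσ σ = (J ⊖ I) ⊖ P σ

-- Latin squares of size n (values {1..n} represented by Fin n);
-- L is given as rows: lookup (lookup L i) j is the (i,j) entry

entry : ∀ {n} → Vec (Vec (Fin n) n) n → Fin n → Fin n → Fin n
entry L i j = lookup (lookup L i) j

RowOnce : ∀ {n} → Vec (Vec (Fin n) n) n → Fin n → Fin n → Set
RowOnce {n} L i k = count (λ j → entry L i j ≟ᶠ k) (allFin n) ≡ 1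

ColOnce : ∀ {n} → Vec (Vec (Fin n) n) n → Fin n → Fin n → Set
ColOnce {n} L j k = count (λ i → entry L i j ≟ᶠ k) (allFin n) ≡ 1

IsLatin : ∀ {n} → Vec (Vec (Fin n) n) n → Set
IsLatin L = (∀ i k → RowOnce L i k) × (∀ j k → ColOnce L j k)

isLatin? : ∀ {n} (L : Vec (Vec (Fin n) n) n) → Dec (IsLatin L)
isLatin? {n} L =
  all? (λ i → all? (λ k → count (λ j → entry L i j ≟ᶠ k) (allFin n) ≟ 1))
  ×-dec all? (λ j → all? (λ k → count (λ i → entry L i j ≟ᶠ k) (allFin n) ≟ 1))

numLatin : ℕ → ℕ
numLatin n = count isLatin? (vecs (vecs (allFin n) n) n)

{-# OPTIONS --safe #-}
-- A maximal chain 0̂ → M is a sequence of permutations whose matrices sum to M, and peeling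
-- off its first permutation τ leaves a chain 0̂ → M − P_τ. For M = J every τ may come first,
-- and relabelling the rows by τ⁻¹ carries J − P_τ to J − I, whence v(J) = n! v(J − I).
-- For M = J − I exactly the derangements τ may come first, leaving a chain to M_τ; conjugating
-- by π relabels rows and columns simultaneously, so v(M_τ) depends only on the conjugacy class
-- of τ, and grouping the τ by class gives the sum formula. Finally, n permutations whose
-- matrices sum to J are exactly the rows of a Latin square.
module Submission where

open import Defs
open import Data.Bool using (true; false; if_then_else_)
open import Data.Empty using (⊥-elim)
open import Data.Fin using (Fin; zero; suc; punchIn; punchOut) renaming (_≟_ to _≟ᶠ_)
open import Data.Fin.Properties
  using (any?; injective⇒≤; punchOut-injective; punchIn-injective; punchInᵢ≢i; punchIn-punchOut; suc-injective)
import Data.Fin.Permutation as Permutation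
open import Data.Fin.Permutation using (Permutation′; permutation; flip; _∘ₚ_; _⟨$⟩ʳ_; _⟨$⟩ˡ_; inverseˡ; inverseʳ)
open import Data.List using (List; []; _∷_; [_]; allFin; filter; length; map; _++_; concatMap; cartesianProductWith)
open import Data.List.Properties using (length-map; length-++; filter-++; map-cong-local; map-tabulate; length-tabulate)
open import Data.List.Membership.Propositional using (_∈_; find; lose)
open import Data.List.Membership.Propositional.Properties
  using (∈-allFin; ∈-cartesianProductWith⁺; ∈-cartesianProductWith⁻; ∈-filter⁺; ∈-filter⁻; ∈-map⁺; ∈-map⁻)
open import Data.List.Membership.Propositional.Properties.WithK using (unique∧set⇒bag)
open import Data.List.Relation.Binary.BagAndSetEquality using (∼bag⇒↭)
open import Data.List.Relation.Binary.Permutation.Propositional.Properties using (↭-length)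
open import Data.List.Relation.Unary.All using (All)
import Data.List.Relation.Unary.All as All
open import Data.List.Relation.Unary.AllPairs using (AllPairs; []; _∷_)
open import Data.List.Relation.Unary.Any using (Any; here; there)
open import Data.List.Relation.Unary.Unique.Propositional using (Unique)
import Data.List.Relation.Unary.Unique.Propositional.Properties as Unique
open import Data.Nat using (ℕ; zero; suc; _+_; _*_; _∸_; _≤_; _<_; _!; z≤n; s≤s)
open import Data.Nat.ListAction using (sum)
open import Data.Nat.Properties
  using (≤-trans; ≤-antisym; ≤-reflexive; n≤1+n; 1+n≰n; <⇒≱; m≤m+n; *-zeroʳ; *-identityˡ; *-identityʳ;
         m∸n+n≡m; m+n∸n≡m; m+n∸m≡n; m+[n∸m]≡n; +-commutativeSemigroup)
open import Algebra.Properties.CommutativeSemigroup +-commutativeSemigroup using () renaming (interchange to +-interchange)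
open import Data.Product using (∃; _×_; _,_; proj₁; proj₂)
open import Data.Vec using (Vec; []; _∷_; lookup; tabulate)
import Data.Vec as Vec
open import Data.Vec.Properties
  using (∷-injective; lookup-map; lookup∘tabulate; tabulate∘lookup; tabulate-cong; map-∘; map-cong; map-id)
open import Function using (_∘_; id)
open import Function.Bundles using (Injection; mk⇔)
open import Function.Properties.Inverse using (↔⇒↣)
open import Relation.Nullary using (Dec; yes; no; ¬_; does)
open import Relation.Binary.PropositionalEquality
  using (_≡_; _≢_; refl; sym; trans; cong; cong₂; subst; module ≡-Reasoning)

module _ {A : Set} {P : A → Set} (P? : ∀ a → Dec (P a)) where

  count-++ : ∀ xs ys → count P? (xs ++ ys) ≡ count P? xs + count P? ys
  count-++ xs ys = trans (cong length (filter-++ P? xs ys)) (length-++ (filter P? xs))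

  count-map : ∀ {B : Set} (f : B → A) xs → count P? (map f xs) ≡ count (λ b → P? (f b)) xs
  count-map f [] = refl
  count-map f (x ∷ xs) with P? (f x)
  ... | yes _ = cong suc (count-map f xs)
  ... | no _  = count-map f xs

  count-cartesianProductWith : ∀ {B C : Set} (f : B → C → A) xs ys →
    count P? (cartesianProductWith f xs ys) ≡ sum (map (λ x → count (λ y → P? (f x y)) ys) xs)
  count-cartesianProductWith f [] ys = refl
  count-cartesianProductWith f (x ∷ xs) ys =
    trans (count-++ (map (f x) ys) _)
          (cong₂ _+_ (count-map (f x) ys) (count-cartesianProductWith f xs ys))

  count-singleton : ∀ x → count P? [ x ] ≡ (if does (P? x) then 1 else 0)
  count-singleton x with does (P? x)
  ... | true  = refl
  ... | false = refl

  count-cong : ∀ {Q : A → Set} (Q? : ∀ a → Dec (Q a)) xs →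
    (∀ {x} → x ∈ xs → P x → Q x) → (∀ {x} → x ∈ xs → Q x → P x) → count P? xs ≡ count Q? xs
  count-cong Q? [] _ _ = refl
  count-cong Q? (x ∷ xs) P⇒Q Q⇒P with P? x | Q? x
  ... | yes _ | yes _ = cong suc (count-cong Q? xs (P⇒Q ∘ there) (Q⇒P ∘ there))
  ... | yes p | no ¬q = ⊥-elim (¬q (P⇒Q (here refl) p))
  ... | no ¬p | yes q = ⊥-elim (¬p (Q⇒P (here refl) q))
  ... | no _  | no _  = count-cong Q? xs (P⇒Q ∘ there) (Q⇒P ∘ there)

  count≡0 : ∀ xs → (∀ {x} → x ∈ xs → ¬ P x) → count P? xs ≡ 0
  count≡0 [] _ = refl
  count≡0 (x ∷ xs) ¬P with P? x
  ... | yes p = ⊥-elim (¬P (here refl) p)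
  ... | no _  = count≡0 xs (¬P ∘ there)

  count≥1 : ∀ {xs a} → a ∈ xs → P a → 1 ≤ count P? xs
  count≥1 {x ∷ xs} a∈xs pa with P? x
  ... | yes _ = s≤s z≤n
  count≥1 {x ∷ xs} (here refl) pa | no ¬px = ⊥-elim (¬px pa)
  count≥1 {x ∷ xs} (there a∈xs) pa | no _ = count≥1 a∈xs pa

  count≥2 : ∀ {xs a b} → a ≢ b → a ∈ xs → b ∈ xs → P a → P b → 2 ≤ count P? xs
  count≥2 {x ∷ xs} a≢b (here refl) (here refl) _ _ = ⊥-elim (a≢b refl)
  count≥2 {x ∷ xs} a≢b (here refl) (there b∈xs) pa pb with P? x
  ... | yes _ = s≤s (count≥1 b∈xs pb)
  ... | no ¬pa = ⊥-elim (¬pa pa)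
  count≥2 {x ∷ xs} a≢b (there a∈xs) (here refl) pa pb with P? x
  ... | yes _ = s≤s (count≥1 a∈xs pa)
  ... | no ¬pb = ⊥-elim (¬pb pb)
  count≥2 {x ∷ xs} a≢b (there a∈xs) (there b∈xs) pa pb with P? x
  ... | yes _ = ≤-trans (count≥2 a≢b a∈xs b∈xs pa pb) (n≤1+n _)
  ... | no _  = count≥2 a≢b a∈xs b∈xs pa pb

  count≡1 : ∀ {R : A → A → Set} {xs a} → AllPairs R xs → (∀ {b c} → P b → P c → ¬ R b c) →
    a ∈ xs → P a → count P? xs ≡ 1
  count≡1 {xs = xs} {a} pairs unrelated a∈xs pa = ≤-antisym (atMostOne xs pairs) (count≥1 a∈xs pa)
    where
    atMostOne : ∀ ys → AllPairs _ ys → count P? ys ≤ 1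
    atMostOne [] [] = z≤n
    atMostOne (y ∷ ys) (y-R ∷ rest) with P? y
    ... | yes py = s≤s (≤-reflexive (count≡0 ys (λ z∈ys pz → unrelated py pz (All.lookup y-R z∈ys))))
    ... | no _  = atMostOne ys rest

  sum-if : ∀ {f : A → ℕ} {c} xs → (∀ {x} → x ∈ xs → P x → f x ≡ c) →
    sum (map (λ x → if does (P? x) then f x else 0) xs) ≡ count P? xs * c
  sum-if [] _ = refl
  sum-if (x ∷ xs) f≡c with P? x
  ... | yes px = cong₂ _+_ (f≡c (here refl) px) (sum-if xs (f≡c ∘ there))
  ... | no _  = sum-if xs (f≡c ∘ there)

module _ {A B : Set} {P : A → Set} {Q : B → Set} (P? : ∀ a → Dec (P a)) (Q? : ∀ b → Dec (Q b)) where

  count-bijection : ∀ {xs ys} → Unique xs → Unique ys → (f : A → B) → (∀ {a a′} → f a ≡ f a′ → a ≡ a′) →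
    (∀ {a} → a ∈ xs → P a → f a ∈ ys × Q (f a)) →
    (∀ {b} → b ∈ ys → Q b → ∃ λ a → a ∈ xs × P a × f a ≡ b) →
    count P? xs ≡ count Q? ys
  count-bijection {xs} {ys} xs-unique ys-unique f f-injective into onto =
    trans (sym (length-map f (filter P? xs)))
          (↭-length (∼bag⇒↭ (unique∧set⇒bag image-unique (Unique.filter⁺ Q? ys-unique) (mk⇔ ⊆ ⊇))))
    where
    image-unique : Unique (map f (filter P? xs))
    image-unique = Unique.map⁺ f-injective (Unique.filter⁺ P? xs-unique)
    ⊆ : ∀ {b} → b ∈ map f (filter P? xs) → b ∈ filter Q? ys
    ⊆ b∈ with ∈-map⁻ f b∈
    ... | a , a∈ , refl with ∈-filter⁻ P? a∈
    ... | a∈xs , pa with into a∈xs pa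
    ... | fa∈ys , qfa = ∈-filter⁺ Q? fa∈ys qfa
    ⊇ : ∀ {b} → b ∈ filter Q? ys → b ∈ map f (filter P? xs)
    ⊇ b∈ with ∈-filter⁻ Q? b∈
    ... | b∈ys , qb with onto b∈ys qb
    ... | a , a∈xs , pa , refl = ∈-map⁺ f (∈-filter⁺ P? a∈xs pa)

count-allFin-suc : ∀ {k} {P : Fin (suc k) → Set} (P? : ∀ i → Dec (P i)) →
  count P? (allFin (suc k)) ≡ (if does (P? zero) then 1 else 0) + count (P? ∘ suc) (allFin k)
count-allFin-suc {k} P? = trans (count-++ P? [ zero ] _) (cong₂ _+_ (count-singleton P? zero)
  (trans (cong (count P?) (sym (map-tabulate id suc))) (count-map P? suc (allFin k))))

sum-cong : ∀ {A : Set} {f g : A → ℕ} xs → (∀ {x} → x ∈ xs → f x ≡ g x) → sum (map f xs) ≡ sum (map g xs)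
sum-cong xs f≡g = cong sum (map-cong-local (All.tabulate f≡g))

sum-const : ∀ {A : Set} (xs : List A) c → sum (map (λ _ → c) xs) ≡ length xs * c
sum-const [] c = refl
sum-const (x ∷ xs) c = cong (c +_) (sum-const xs c)

sum-+ : ∀ {A : Set} (f g : A → ℕ) xs → sum (map (λ x → f x + g x) xs) ≡ sum (map f xs) + sum (map g xs)
sum-+ f g [] = refl
sum-+ f g (x ∷ xs) = trans (cong (f x + g x +_) (sum-+ f g xs)) (+-interchange (f x) (g x) _ _)

sum-swap : ∀ {A B : Set} (f : A → B → ℕ) xs ys →
  sum (map (λ x → sum (map (f x) ys)) xs) ≡ sum (map (λ y → sum (map (λ x → f x y) xs)) ys)
sum-swap f [] ys = sym (trans (sum-cong ys (λ _ → refl)) (trans (sum-const ys 0) (*-zeroʳ (length ys))))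
sum-swap f (x ∷ xs) ys =
  trans (cong (sum (map (f x) ys) +_) (sum-swap f xs ys)) (sym (sum-+ (f x) _ ys))

vecs-suc : ∀ {A : Set} (xs : List A) k → vecs xs (suc k) ≡ cartesianProductWith _∷_ xs (vecs xs k)
vecs-suc xs k = concatMap-as-product xs
  where
  concatMap-as-product : ∀ zs → concatMap (λ x → map (x ∷_) (vecs xs k)) zs ≡ cartesianProductWith _∷_ zs (vecs xs k)
  concatMap-as-product [] = refl
  concatMap-as-product (z ∷ zs) = cong (map (z ∷_) (vecs xs k) ++_) (concatMap-as-product zs)

vecs-unique : ∀ {A : Set} {xs : List A} k → Unique xs → Unique (vecs xs k)
vecs-unique zero _ = All.[] ∷ []
vecs-unique {xs = xs} (suc k) xs-unique rewrite vecs-suc xs k =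
  Unique.cartesianProductWith⁺ _∷_ ∷-injective xs-unique (vecs-unique k xs-unique)

∈-vecs⁺ : ∀ {A : Set} {xs : List A} {k} (w : Vec A k) → (∀ i → lookup w i ∈ xs) → w ∈ vecs xs k
∈-vecs⁺ [] _ = here refl
∈-vecs⁺ {xs = xs} {suc k} (a ∷ w) w⊆xs rewrite vecs-suc xs k =
  ∈-cartesianProductWith⁺ _∷_ (w⊆xs zero) (∈-vecs⁺ w (w⊆xs ∘ suc))

∈-vecs⁻ : ∀ {A : Set} {xs : List A} {k} {w : Vec A k} → w ∈ vecs xs k → ∀ i → lookup w i ∈ xs
∈-vecs⁻ {xs = xs} {suc k} w∈ i rewrite vecs-suc xs k
  with _ , _ , a∈xs , u∈vecs , refl ← ∈-cartesianProductWith⁻ _∷_ xs (vecs xs k) w∈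
  with i
... | zero = a∈xs
... | suc i = ∈-vecs⁻ u∈vecs i

count-vecs-suc : ∀ {A : Set} {k} {Q : Vec A (suc k) → Set} (Q? : ∀ w → Dec (Q w)) xs →
  count Q? (vecs xs (suc k)) ≡ sum (map (λ x → count (λ w → Q? (x ∷ w)) (vecs xs k)) xs)
count-vecs-suc {k = k} Q? xs rewrite vecs-suc xs k = count-cartesianProductWith Q? _∷_ xs (vecs xs k)

∈-vecs-map : ∀ {A : Set} {xs : List A} {k} {f : A → A} → (∀ {x} → x ∈ xs → f x ∈ xs) →
  ∀ {w : Vec A k} → w ∈ vecs xs k → Vec.map f w ∈ vecs xs k
∈-vecs-map {f = f} f-closed {w} w∈ = ∈-vecs⁺ _ λ i → subst (_∈ _) (sym (lookup-map i f w)) (f-closed (∈-vecs⁻ w∈ i))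

vec-ext : ∀ {A : Set} {n} {u w : Vec A n} → (∀ i → lookup u i ≡ lookup w i) → u ≡ w
vec-ext {u = u} {w} u≗w = trans (sym (tabulate∘lookup u)) (trans (tabulate-cong u≗w) (tabulate∘lookup w))

map-injective : ∀ {A B : Set} {f : A → B} → (∀ {x y} → f x ≡ f y → x ≡ y) →
  ∀ {k} {u w : Vec A k} → Vec.map f u ≡ Vec.map f w → u ≡ w
map-injective {f = f} f-injective {u = u} {w} eq = vec-ext λ i →
  f-injective (trans (sym (lookup-map i f u)) (trans (cong (λ x → lookup x i) eq) (lookup-map i f w)))

map-leftInverse : ∀ {A B : Set} {f : A → B} {g : B → A} → (∀ x → g (f x) ≡ x) →
  ∀ {k} {w : Vec A k} → Vec.map g (Vec.map f w) ≡ w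
map-leftInverse {f = f} {g} g∘f≗id {w = w} = trans (sym (map-∘ g f w)) (trans (map-cong g∘f≗id w) (map-id w))

-- If σ missed k, punching k out of its values would inject Fin n into Fin (n ∸ 1).
IsPerm⇒surjective : ∀ {n} (σ : Vec (Fin n) n) → IsPerm σ → ∀ k → ∃ λ i → lookup σ i ≡ k
IsPerm⇒surjective σ σ-perm k with any? (λ i → lookup σ i ≟ᶠ k)
... | yes hit = hit
IsPerm⇒surjective {suc m} σ σ-perm k | no miss = ⊥-elim (1+n≰n (injective⇒≤ avoid-k-injective))
  where
  avoid-k : Fin (suc m) → Fin m
  avoid-k i = punchOut {i = k} (λ k≡σi → miss (i , sym k≡σi))
  avoid-k-injective : ∀ {i j} → avoid-k i ≡ avoid-k j → i ≡ j
  avoid-k-injective eq = σ-perm _ _ (punchOut-injective {i = k} _ _ eq)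

module _ {n} (σ : Vec (Fin n) n) (σ-perm : IsPerm σ) where

  private
    preimage = IsPerm⇒surjective σ σ-perm

  toPermutation : Permutation′ n
  toPermutation = permutation (lookup σ) (proj₁ ∘ preimage) (proj₂ ∘ preimage)
    (λ i → σ-perm _ _ (proj₂ (preimage (lookup σ i))))

tabulate-perm : ∀ {n} (α : Permutation′ n) → IsPerm (tabulate (α ⟨$⟩ʳ_))
tabulate-perm α i j eq = trans (sym (inverseˡ α))
  (trans (cong (α ⟨$⟩ˡ_) (trans (sym (lookup∘tabulate _ i)) (trans eq (lookup∘tabulate _ j)))) (inverseˡ α))

∈-perms⁺ : ∀ {n} {σ : Vec (Fin n) n} → IsPerm σ → σ ∈ perms n
∈-perms⁺ {σ = σ} = ∈-filter⁺ isPerm? (∈-vecs⁺ σ (λ i → ∈-allFin _))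

∈-perms⁻ : ∀ {n} {σ : Vec (Fin n) n} → σ ∈ perms n → IsPerm σ
∈-perms⁻ {n} = proj₂ ∘ ∈-filter⁻ isPerm? {xs = vecs (allFin n) n}

perms-unique : ∀ n → Unique (perms n)
perms-unique n = Unique.filter⁺ isPerm? (vecs-unique n (Unique.allFin⁺ n))

module _ {n} (a : Fin (suc n)) where

  IsPerm-∷-punchIn : ∀ {τ} → IsPerm τ → IsPerm (a ∷ Vec.map (punchIn a) τ)
  IsPerm-∷-punchIn τ-perm zero zero _ = refl
  IsPerm-∷-punchIn {τ} τ-perm zero (suc j) eq = ⊥-elim (punchInᵢ≢i a (lookup τ j) (sym (trans eq (lookup-map j _ τ))))
  IsPerm-∷-punchIn {τ} τ-perm (suc i) zero eq = ⊥-elim (punchInᵢ≢i a (lookup τ i) (trans (sym (lookup-map i _ τ)) eq))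
  IsPerm-∷-punchIn {τ} τ-perm (suc i) (suc j) eq =
    cong suc (τ-perm i j (punchIn-injective a _ _ (trans (sym (lookup-map i _ τ)) (trans eq (lookup-map j _ τ)))))

  IsPerm-∷-punchOut : ∀ {w} (w-perm : IsPerm (a ∷ w)) → ∃ λ τ → IsPerm τ × Vec.map (punchIn a) τ ≡ w
  IsPerm-∷-punchOut {w} w-perm = τ , τ-perm , vec-ext λ i →
    trans (lookup-map i (punchIn a) τ) (trans (cong (punchIn a) (lookup∘tabulate _ i)) (punchIn-punchOut (a≢w i)))
    where
    a≢w : ∀ i → a ≢ lookup w i
    a≢w i eq with () ← w-perm zero (suc i) eq
    τ : Vec (Fin n) n
    τ = tabulate (λ i → punchOut (a≢w i))
    τ-perm : IsPerm τ
    τ-perm i j eq = suc-injective (w-perm (suc i) (suc j)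
      (punchOut-injective (a≢w i) (a≢w j) (trans (sym (lookup∘tabulate _ i)) (trans eq (lookup∘tabulate _ j)))))

  count-perms-∷ : count (λ w → isPerm? (a ∷ w)) (vecs (allFin (suc n)) n) ≡ length (perms n)
  count-perms-∷ = sym (count-bijection isPerm? (λ w → isPerm? (a ∷ w))
    (vecs-unique n (Unique.allFin⁺ n)) (vecs-unique n (Unique.allFin⁺ (suc n)))
    (Vec.map (punchIn a)) (map-injective (punchIn-injective a _ _))
    (λ _ τ-perm → ∈-vecs⁺ _ (λ i → ∈-allFin _) , IsPerm-∷-punchIn τ-perm)
    (λ _ w-perm → let τ , τ-perm , eq = IsPerm-∷-punchOut w-perm in τ , ∈-vecs⁺ τ (λ i → ∈-allFin _) , τ-perm , eq))

length-perms : ∀ n → length (perms n) ≡ n !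
length-perms zero = refl
length-perms (suc n) = begin
  count isPerm? (vecs (allFin (suc n)) (suc n))
    ≡⟨ count-vecs-suc {k = n} isPerm? (allFin (suc n)) ⟩
  sum (map (λ a → count (λ w → isPerm? (a ∷ w)) (vecs (allFin (suc n)) n)) (allFin (suc n)))
    ≡⟨ sum-cong (allFin (suc n)) (λ {a} _ → trans (count-perms-∷ a) (length-perms n)) ⟩
  sum (map (λ _ → n !) (allFin (suc n)))
    ≡⟨ sum-const (allFin (suc n)) (n !) ⟩
  length (allFin (suc n)) * n !
    ≡⟨ cong (_* n !) (length-tabulate {n = suc n} id) ⟩
  suc n !
    ∎
  where open ≡-Reasoning

δ-refl : ∀ {n} (a : Fin n) → δ a a ≡ 1
δ-refl a with a ≟ᶠ a
... | yes _ = refl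
... | no a≢a = ⊥-elim (a≢a refl)

δ-≢ : ∀ {n} {a b : Fin n} → a ≢ b → δ a b ≡ 0
δ-≢ {a = a} {b} a≢b with a ≟ᶠ b
... | yes a≡b = ⊥-elim (a≢b a≡b)
... | no _ = refl

δ≤1 : ∀ {n} (a b : Fin n) → δ a b ≤ 1
δ≤1 a b with a ≟ᶠ b
... | yes _ = s≤s z≤n
... | no _ = z≤n

δ-cong : ∀ {m n} {a b : Fin m} {c d : Fin n} → (a ≡ b → c ≡ d) → (c ≡ d → a ≡ b) → δ a b ≡ δ c d
δ-cong {a = a} {b} {c} {d} ab⇒cd cd⇒ab with a ≟ᶠ b | c ≟ᶠ d
... | yes _   | yes _   = refl
... | yes a≡b | no c≢d  = ⊥-elim (c≢d (ab⇒cd a≡b))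
... | no a≢b  | yes c≡d = ⊥-elim (a≢b (cd⇒ab c≡d))
... | no _    | no _    = refl

rowSum : ∀ {n} → (Fin n → ℕ) → ℕ
rowSum f = Vec.sum (tabulate f)

rowSum-+ : ∀ {n} (f g : Fin n → ℕ) → rowSum (λ j → f j + g j) ≡ rowSum f + rowSum g
rowSum-+ {zero} f g = refl
rowSum-+ {suc n} f g = trans (cong (f zero + g zero +_) (rowSum-+ (f ∘ suc) (g ∘ suc))) (+-interchange (f zero) (g zero) _ _)

rowSum-const : ∀ n c → rowSum {n} (λ _ → c) ≡ n * c
rowSum-const zero c = refl
rowSum-const (suc n) c = cong (c +_) (rowSum-const n c)

rowSum-δ : ∀ {n} (a : Fin n) → rowSum (δ a) ≡ 1
rowSum-δ {suc n} zero = cong suc (trans (rowSum-const n 0) (*-zeroʳ n))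
rowSum-δ {suc n} (suc a) = rowSum-δ a

rowSum-∸δ : ∀ {n} (f : Fin n → ℕ) a → (∀ j → δ a j ≤ f j) → rowSum (λ j → f j ∸ δ a j) ≡ rowSum f ∸ 1
rowSum-∸δ f a δ≤f = sym (begin
  rowSum f ∸ 1
    ≡⟨ cong (λ s → Vec.sum s ∸ 1) (tabulate-cong (λ j → sym (m∸n+n≡m (δ≤f j)))) ⟩
  rowSum (λ j → f j ∸ δ a j + δ a j) ∸ 1
    ≡⟨ cong (_∸ 1) (rowSum-+ _ (δ a)) ⟩
  rowSum (λ j → f j ∸ δ a j) + rowSum (δ a) ∸ 1
    ≡⟨ cong (λ s → rowSum (λ j → f j ∸ δ a j) + s ∸ 1) (rowSum-δ a) ⟩
  rowSum (λ j → f j ∸ δ a j) + 1 ∸ 1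
    ≡⟨ m+n∸n≡m _ 1 ⟩
  rowSum (λ j → f j ∸ δ a j)
    ∎)
  where open ≡-Reasoning

lineSum-J : ∀ n → lineSum {n} J ≡ n
lineSum-J zero = refl
lineSum-J (suc n) = trans (rowSum-const (suc n) 1) (*-identityʳ (suc n))

lineSum-J⊖I : ∀ m → lineSum {suc m} (J ⊖ I) ≡ m
lineSum-J⊖I m = trans (rowSum-∸δ {suc m} (λ _ → 1) zero (δ≤1 zero)) (cong (_∸ 1) (lineSum-J (suc m)))

P≤J⊖I : ∀ {n} (τ : Vec (Fin n) n) → IsDerangement τ → ∀ i j → P τ i j ≤ (J ⊖ I) i j
P≤J⊖I τ τ-der i j with lookup τ i ≟ᶠ j
... | no _ = z≤n
... | yes refl rewrite δ-≢ (τ-der i ∘ sym) = s≤s z≤n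

lineSum-Mσ : ∀ m (τ : Vec (Fin (suc (suc m))) (suc (suc m))) → IsDerangement τ → lineSum (Mσ τ) ≡ m
lineSum-Mσ m τ τ-der =
  trans (rowSum-∸δ ((J ⊖ I) zero) (lookup τ zero) (P≤J⊖I τ τ-der zero)) (cong (_∸ 1) (lineSum-J⊖I (suc m)))

J⊖I<P-fixedPoint : ∀ {n} (τ : Vec (Fin n) n) {k} → lookup τ k ≡ k → (J ⊖ I) k k < P τ k k
J⊖I<P-fixedPoint τ {k} τk≡k rewrite τk≡k | δ-refl k = s≤s z≤n

chains : ∀ {n} → ℕ → Mat n → ℕ
chains {n} k M = count (λ ps → sumP ps ≐? M) (vecs (perms n) k)

chainsFrom : ∀ {n} → Vec (Fin n) n → ℕ → Mat n → ℕ
chainsFrom {n} τ k M = count (λ ps → sumP (τ ∷ ps) ≐? M) (vecs (perms n) k)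

v≡chains : ∀ {n} (M : Mat n) {k} → lineSum M ≡ k → v M ≡ chains k M
v≡chains M refl = refl

chains-suc : ∀ {n} k (M : Mat n) → chains (suc k) M ≡ sum (map (λ τ → chainsFrom τ k M) (perms n))
chains-suc {n} k M = count-vecs-suc {k = k} (λ ps → sumP ps ≐? M) (perms n)

chains-cong : ∀ {n} k {M N : Mat n} → M ≐ N → chains k M ≡ chains k N
chains-cong {n} k {M} {N} M≐N = count-cong (λ ps → sumP ps ≐? M) (λ ps → sumP ps ≐? N) (vecs (perms n) k)
  (λ _ S≐M i j → trans (S≐M i j) (M≐N i j)) (λ _ S≐N i j → trans (S≐N i j) (sym (M≐N i j)))

chainsFrom-peel : ∀ {n} k (M : Mat n) τ → (∀ i j → P τ i j ≤ M i j) → chainsFrom τ k M ≡ chains k (M ⊖ P τ)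
chainsFrom-peel {n} k M τ P≤M =
  count-cong (λ ps → sumP (τ ∷ ps) ≐? M) (λ ps → sumP ps ≐? (M ⊖ P τ)) (vecs (perms n) k)
    (λ _ sum≐M i j → trans (sym (m+n∸m≡n (P τ i j) _)) (cong (_∸ P τ i j) (sum≐M i j)))
    (λ _ sum≐M∸P i j → trans (cong (P τ i j +_) (sum≐M∸P i j)) (m+[n∸m]≡n (P≤M i j)))

chainsFrom-≡0 : ∀ {n} k (M : Mat n) τ i j → M i j < P τ i j → chainsFrom τ k M ≡ 0
chainsFrom-≡0 {n} k M τ i j M<P = count≡0 (λ ps → sumP (τ ∷ ps) ≐? M) (vecs (perms n) k)
  (λ {ps} _ sum≐M → <⇒≱ M<P (subst (P τ i j ≤_) (sum≐M i j) (m≤m+n _ (sumP ps i j))))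

⟨$⟩ʳ-injective : ∀ {n} (α : Permutation′ n) {x y} → α ⟨$⟩ʳ x ≡ α ⟨$⟩ʳ y → x ≡ y
⟨$⟩ʳ-injective α = Injection.injective (↔⇒↣ α)

δ-⟨$⟩ʳ : ∀ {n} (α : Permutation′ n) x y → δ (α ⟨$⟩ʳ x) (α ⟨$⟩ʳ y) ≡ δ x y
δ-⟨$⟩ʳ α x y = δ-cong (⟨$⟩ʳ-injective α) (cong (α ⟨$⟩ʳ_))

δ-⟨$⟩ˡ : ∀ {n} (α : Permutation′ n) x y → δ (α ⟨$⟩ˡ x) y ≡ δ x (α ⟨$⟩ʳ y)
δ-⟨$⟩ˡ α x y = δ-cong
  (λ eq → trans (sym (inverseʳ α)) (cong (α ⟨$⟩ʳ_) eq))
  (λ eq → trans (cong (α ⟨$⟩ˡ_) eq) (inverseˡ α))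

relabel : ∀ {n} → Permutation′ n → Permutation′ n → Vec (Fin n) n → Vec (Fin n) n
relabel α β ρ = tabulate (λ i → α ⟨$⟩ˡ lookup ρ (β ⟨$⟩ʳ i))

module _ {n} (α β : Permutation′ n) where

  relabel-perm : ∀ ρ → IsPerm ρ → IsPerm (relabel α β ρ)
  relabel-perm ρ ρ-perm i j eq = ⟨$⟩ʳ-injective β (ρ-perm _ _ (⟨$⟩ʳ-injective (flip α)
    (trans (sym (lookup∘tabulate _ i)) (trans eq (lookup∘tabulate _ j)))))

  relabel-flip : ∀ ρ → relabel (flip α) (flip β) (relabel α β ρ) ≡ ρ
  relabel-flip ρ = vec-ext λ i → begin
    lookup (relabel (flip α) (flip β) (relabel α β ρ)) i  ≡⟨ lookup∘tabulate _ i ⟩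
    α ⟨$⟩ʳ lookup (relabel α β ρ) (β ⟨$⟩ˡ i)               ≡⟨ cong (α ⟨$⟩ʳ_) (lookup∘tabulate _ (β ⟨$⟩ˡ i)) ⟩
    α ⟨$⟩ʳ (α ⟨$⟩ˡ lookup ρ (β ⟨$⟩ʳ (β ⟨$⟩ˡ i)))            ≡⟨ inverseʳ α ⟩
    lookup ρ (β ⟨$⟩ʳ (β ⟨$⟩ˡ i))                           ≡⟨ cong (lookup ρ) (inverseʳ β) ⟩
    lookup ρ i                                            ∎
    where open ≡-Reasoning

  relabel-injective : ∀ {ρ ρ′} → relabel α β ρ ≡ relabel α β ρ′ → ρ ≡ ρ′
  relabel-injective {ρ} {ρ′} eq =
    trans (sym (relabel-flip ρ)) (trans (cong (relabel (flip α) (flip β)) eq) (relabel-flip ρ′))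

  sumP-relabel : ∀ {k} (ps : Vec (Vec (Fin n) n) k) i j →
    sumP (Vec.map (relabel α β) ps) i j ≡ sumP ps (β ⟨$⟩ʳ i) (α ⟨$⟩ʳ j)
  sumP-relabel [] i j = refl
  sumP-relabel (ρ ∷ ps) i j = cong₂ _+_
    (trans (cong (λ x → δ x j) (lookup∘tabulate _ i)) (δ-⟨$⟩ˡ α _ j)) (sumP-relabel ps i j)

chains-relabel : ∀ {n} (α β : Permutation′ n) k (M : Mat n) →
  chains k M ≡ chains k (λ i j → M (β ⟨$⟩ʳ i) (α ⟨$⟩ʳ j))
chains-relabel {n} α β k M = count-bijection (λ ps → sumP ps ≐? M) (λ ps → sumP ps ≐? M′)
  (vecs-unique k (perms-unique n)) (vecs-unique k (perms-unique n))
  (Vec.map (relabel α β)) (map-injective (relabel-injective α β))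
  (λ {ps} ps∈ sum≐M → ∈-vecs-map (λ {ρ} ρ∈ → ∈-perms⁺ (relabel-perm α β ρ (∈-perms⁻ ρ∈))) ps∈
    , λ i j → trans (sumP-relabel α β ps i j) (sum≐M _ _))
  (λ {qs} qs∈ sum≐M′ → Vec.map (relabel (flip α) (flip β)) qs
    , ∈-vecs-map (λ {ρ} ρ∈ → ∈-perms⁺ (relabel-perm (flip α) (flip β) ρ (∈-perms⁻ ρ∈))) qs∈
    , (λ i j → trans (sumP-relabel (flip α) (flip β) qs i j) (trans (sum≐M′ _ _) (cong₂ M (inverseʳ β) (inverseʳ α))))
    , map-leftInverse (relabel-flip (flip α) (flip β)))
  where
  M′ : Mat n
  M′ i j = M (β ⟨$⟩ʳ i) (α ⟨$⟩ʳ j)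

module _ {n} {σ τ : Vec (Fin n) n} where

  Conj⇒∃ : Conj σ τ → ∃ λ (α : Permutation′ n) → ∀ i → lookup τ (α ⟨$⟩ʳ i) ≡ α ⟨$⟩ʳ lookup σ i
  Conj⇒∃ conj with π , π∈ , τπ≡πσ ← find conj = toPermutation π (∈-perms⁻ π∈) , τπ≡πσ

  ∃⇒Conj : (α : Permutation′ n) → (∀ i → lookup τ (α ⟨$⟩ʳ i) ≡ α ⟨$⟩ʳ lookup σ i) → Conj σ τ
  ∃⇒Conj α τα≡ασ = lose (∈-perms⁺ {σ = tabulate (α ⟨$⟩ʳ_)} (tabulate-perm α)) λ i →
    trans (cong (lookup τ) (lookup∘tabulate _ i)) (trans (τα≡ασ i) (sym (lookup∘tabulate _ (lookup σ i))))

Conj-sym : ∀ {n} {σ τ : Vec (Fin n) n} → Conj σ τ → Conj τ σ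
Conj-sym {σ = σ} {τ} conj with α , τα≡ασ ← Conj⇒∃ {σ = σ} {τ} conj =
  ∃⇒Conj {σ = τ} {σ} (flip α) λ i → begin
  lookup σ (α ⟨$⟩ˡ i)                         ≡⟨ inverseˡ α ⟨
  α ⟨$⟩ˡ (α ⟨$⟩ʳ lookup σ (α ⟨$⟩ˡ i))          ≡⟨ cong (α ⟨$⟩ˡ_) (τα≡ασ (α ⟨$⟩ˡ i)) ⟨
  α ⟨$⟩ˡ lookup τ (α ⟨$⟩ʳ (α ⟨$⟩ˡ i))          ≡⟨ cong (λ k → α ⟨$⟩ˡ lookup τ k) (inverseʳ α) ⟩
  α ⟨$⟩ˡ lookup τ i                           ∎
  where open ≡-Reasoning

Conj-trans : ∀ {n} {σ τ ρ : Vec (Fin n) n} → Conj σ τ → Conj τ ρ → Conj σ ρ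
Conj-trans {σ = σ} {τ} {ρ} σ~τ τ~ρ
  with α , τα≡ασ ← Conj⇒∃ {σ = σ} {τ} σ~τ | β , ρβ≡βτ ← Conj⇒∃ {σ = τ} {ρ} τ~ρ =
  ∃⇒Conj {σ = σ} {ρ} (α ∘ₚ β) λ i → trans (ρβ≡βτ (α ⟨$⟩ʳ i)) (cong (β ⟨$⟩ʳ_) (τα≡ασ i))

Conj-derangement : ∀ {n} {σ τ : Vec (Fin n) n} → Conj σ τ → IsDerangement σ → IsDerangement τ
Conj-derangement {σ = σ} {τ} conj σ-der k τk≡k with α , τα≡ασ ← Conj⇒∃ {σ = σ} {τ} conj =
  σ-der i (⟨$⟩ʳ-injective α (trans (sym (τα≡ασ i)) (trans (cong (lookup τ) αi≡k) (trans τk≡k (sym αi≡k)))))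
  where
  i = α ⟨$⟩ˡ k
  αi≡k : α ⟨$⟩ʳ i ≡ k
  αi≡k = inverseʳ α

chains-Mσ-Conj : ∀ {n} k {σ τ : Vec (Fin n) n} → Conj σ τ → chains k (Mσ τ) ≡ chains k (Mσ σ)
chains-Mσ-Conj k {σ} {τ} conj with α , τα≡ασ ← Conj⇒∃ {σ = σ} {τ} conj =
  trans (chains-relabel α α k (Mσ τ)) (chains-cong k λ i j →
    cong₂ (λ x y → 1 ∸ x ∸ y) (δ-⟨$⟩ʳ α i j)
      (trans (cong (λ x → δ x (α ⟨$⟩ʳ j)) (τα≡ασ i)) (δ-⟨$⟩ʳ α _ j)))

sumP-count : ∀ {n k} (ps : Vec (Vec (Fin n) n) k) a b → sumP ps a b ≡ count (λ m → lookup (lookup ps m) a ≟ᶠ b) (allFin k)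
sumP-count [] a b = refl
sumP-count (σ ∷ ps) a b = trans (cong (P σ a b +_) (sumP-count ps a b))
  (sym (count-allFin-suc (λ m → lookup (lookup (σ ∷ ps) m) a ≟ᶠ b)))

module _ {n} (L : Vec (Vec (Fin n) n) n) (i : Fin n) where

  IsPerm⇒RowOnce : IsPerm (lookup L i) → ∀ k → RowOnce L i k
  IsPerm⇒RowOnce row-perm k with j , Lij≡k ← IsPerm⇒surjective (lookup L i) row-perm k =
    count≡1 (λ j → entry L i j ≟ᶠ k) (Unique.allFin⁺ n)
      (λ a↦k b↦k a≢b → a≢b (row-perm _ _ (trans a↦k (sym b↦k)))) (∈-allFin j) Lij≡k

  RowOnce⇒IsPerm : (∀ k → RowOnce L i k) → IsPerm (lookup L i)
  RowOnce⇒IsPerm once a b La≡Lb with a ≟ᶠ b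
  ... | yes a≡b = a≡b
  ... | no a≢b = ⊥-elim (<⇒≱ (s≤s (s≤s z≤n)) (subst (2 ≤_) (once (entry L i a))
    (count≥2 (λ j → entry L i j ≟ᶠ entry L i a) a≢b (∈-allFin a) (∈-allFin b) refl (sym La≡Lb))))

v-J≡numLatin : ∀ n → v {n} J ≡ numLatin n
v-J≡numLatin n = trans (v≡chains J (lineSum-J n)) (count-bijection (λ ps → sumP ps ≐? J) isLatin?
  (vecs-unique n (perms-unique n)) (vecs-unique n (vecs-unique n (Unique.allFin⁺ n))) id id
  (λ {L} L∈ L≐J → ∈-vecs⁺ L (λ i → ∈-vecs⁺ _ (λ _ → ∈-allFin _))
    , (λ i → IsPerm⇒RowOnce L i (∈-perms⁻ (∈-vecs⁻ L∈ i)))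
    , (λ j k → trans (sym (sumP-count L j k)) (L≐J j k)))
  (λ {L} _ (rows , cols) → L
    , ∈-vecs⁺ L (λ i → ∈-perms⁺ (RowOnce⇒IsPerm L i (rows i)))
    , (λ j k → trans (sumP-count L j k) (cols j k)) , refl))

chainsFrom-J : ∀ {n} k (σ : Vec (Fin n) n) → IsPerm σ → chainsFrom σ k J ≡ chains k (J ⊖ I)
chainsFrom-J k σ σ-perm = begin
  chainsFrom σ k J
    ≡⟨ chainsFrom-peel k J σ (λ i j → δ≤1 (lookup σ i) j) ⟩
  chains k (J ⊖ P σ)
    ≡⟨ chains-relabel Permutation.id (flip σ̂) k (J ⊖ P σ) ⟩
  chains k (λ i j → 1 ∸ δ (lookup σ (σ̂ ⟨$⟩ˡ i)) j)
    ≡⟨ chains-cong k (λ i j → cong (λ x → 1 ∸ δ x j) (inverseʳ σ̂)) ⟩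
  chains k (J ⊖ I)
    ∎
  where
  open ≡-Reasoning
  σ̂ = toPermutation σ σ-perm

v-J≡n!*v-J⊖I : ∀ n → v {n} J ≡ n ! * v {n} (J ⊖ I)
v-J≡n!*v-J⊖I zero = refl
v-J≡n!*v-J⊖I (suc m) = begin
  v {suc m} J
    ≡⟨ v≡chains {suc m} J (lineSum-J (suc m)) ⟩
  chains {suc m} (suc m) J
    ≡⟨ chains-suc {suc m} m J ⟩
  sum (map (λ σ → chainsFrom σ m J) (perms (suc m)))
    ≡⟨ sum-cong (perms (suc m)) (λ {σ} σ∈ → chainsFrom-J m σ (∈-perms⁻ σ∈)) ⟩
  sum (map (λ _ → chains {suc m} m (J ⊖ I)) (perms (suc m)))
    ≡⟨ sum-const (perms (suc m)) _ ⟩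
  length (perms (suc m)) * chains {suc m} m (J ⊖ I)
    ≡⟨ cong₂ _*_ (length-perms (suc m)) (sym (v≡chains (J ⊖ I) (lineSum-J⊖I m))) ⟩
  suc m ! * v {suc m} (J ⊖ I)
    ∎
  where open ≡-Reasoning

module ClassSum (m : ℕ) (reps : List (Vec (Fin (suc (suc m))) (suc (suc m))))
  (reps-der : All (λ σ → IsPerm σ × IsDerangement σ) reps)
  (reps-cover : ∀ τ → IsPerm τ → IsDerangement τ → Any (λ σ → Conj σ τ) reps)
  (reps-distinct : AllPairs (λ σ σ′ → ¬ Conj σ σ′) reps) where

  n : ℕ
  n = suc (suc m)

  [_~_]_ : Vec (Fin n) n → Vec (Fin n) n → ℕ → ℕ
  [ σ ~ τ ] x = if does (conj? σ τ) then x else 0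

  chainsFrom-J⊖I : ∀ τ → IsPerm τ →
    chainsFrom τ m (J ⊖ I) ≡ sum (map (λ σ → [ σ ~ τ ] chains m (Mσ σ)) reps)
  chainsFrom-J⊖I τ τ-perm with any? (λ k → lookup τ k ≟ᶠ k)
  ... | yes (k , τk≡k) = begin
    chainsFrom τ m (J ⊖ I)
      ≡⟨ chainsFrom-≡0 m (J ⊖ I) τ k k (J⊖I<P-fixedPoint τ τk≡k) ⟩
    0
      ≡⟨ *-zeroʳ (count (λ σ → conj? σ τ) reps) ⟨
    count (λ σ → conj? σ τ) reps * 0
      ≡⟨ sum-if (λ σ → conj? σ τ) reps (λ {σ} σ∈ σ~τ →
        ⊥-elim (Conj-derangement {σ = σ} {τ} σ~τ (proj₂ (All.lookup reps-der σ∈)) k τk≡k)) ⟨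
    sum (map (λ σ → [ σ ~ τ ] chains m (Mσ σ)) reps)
      ∎
    where open ≡-Reasoning
  ... | no no-fixedPoint = begin
    chainsFrom τ m (J ⊖ I)
      ≡⟨ chainsFrom-peel m (J ⊖ I) τ (P≤J⊖I τ τ-der) ⟩
    chains m (Mσ τ)
      ≡⟨ *-identityˡ _ ⟨
    1 * chains m (Mσ τ)
      ≡⟨ cong (_* chains m (Mσ τ)) one-representative ⟨
    count (λ σ → conj? σ τ) reps * chains m (Mσ τ)
      ≡⟨ sum-if (λ σ → conj? σ τ) reps (λ {σ} _ σ~τ → sym (chains-Mσ-Conj m {σ} {τ} σ~τ)) ⟨
    sum (map (λ σ → [ σ ~ τ ] chains m (Mσ σ)) reps)
      ∎
    where
    open ≡-Reasoning
    τ-der : IsDerangement τ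
    τ-der k τk≡k = no-fixedPoint (k , τk≡k)
    one-representative : count (λ σ → conj? σ τ) reps ≡ 1
    one-representative with σ₀ , σ₀∈ , σ₀~τ ← find (reps-cover τ τ-perm τ-der) =
      count≡1 (λ σ → conj? σ τ) reps-distinct
        (λ {σ} {σ′} σ~τ σ′~τ ¬σ~σ′ → ¬σ~σ′ (Conj-trans {σ = σ} {τ} {σ′} σ~τ (Conj-sym {σ = σ′} {τ} σ′~τ)))
        σ₀∈ σ₀~τ

  classSum : v {n} (J ⊖ I) ≡ sum (map (λ σ → classSize σ * v (Mσ σ)) reps)
  classSum = begin
    v {n} (J ⊖ I)
      ≡⟨ v≡chains {n} (J ⊖ I) (lineSum-J⊖I (suc m)) ⟩
    chains {n} (suc m) (J ⊖ I)
      ≡⟨ chains-suc {n} m (J ⊖ I) ⟩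
    sum (map (λ τ → chainsFrom τ m (J ⊖ I)) (perms n))
      ≡⟨ sum-cong (perms n) (λ {τ} τ∈ → chainsFrom-J⊖I τ (∈-perms⁻ τ∈)) ⟩
    sum (map (λ τ → sum (map (λ σ → [ σ ~ τ ] chains m (Mσ σ)) reps)) (perms n))
      ≡⟨ sum-swap (λ τ σ → [ σ ~ τ ] chains m (Mσ σ)) (perms n) reps ⟩
    sum (map (λ σ → sum (map (λ τ → [ σ ~ τ ] chains m (Mσ σ)) (perms n))) reps)
      ≡⟨ sum-cong reps (λ {σ} _ → sum-if (conj? σ) (perms n) (λ _ _ → refl)) ⟩
    sum (map (λ σ → classSize σ * chains m (Mσ σ)) reps)
      ≡⟨ sum-cong reps (λ {σ} σ∈ → cong (classSize σ *_) (v-Mσ σ∈)) ⟨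
    sum (map (λ σ → classSize σ * v (Mσ σ)) reps)
      ∎
    where
    open ≡-Reasoning
    v-Mσ : ∀ {σ} → σ ∈ reps → v (Mσ σ) ≡ chains m (Mσ σ)
    v-Mσ {σ} σ∈ = v≡chains (Mσ σ) (lineSum-Mσ m σ (proj₂ (All.lookup reps-der σ∈)))

proposition4p8 : (n : ℕ) →
    (2 ≤ n →
      (reps : List (Vec (Fin n) n)) →
      All (λ σ → IsPerm σ × IsDerangement σ) reps →
      (∀ τ → IsPerm τ → IsDerangement τ → Any (λ σ → Conj σ τ) reps) →
      AllPairs (λ σ σ′ → ¬ Conj σ σ′) reps →
      v {n} (J ⊖ I) ≡ sum (map (λ σ → classSize σ * v (Mσ σ)) reps))
    × (v {n} J ≡ n ! * v {n} (J ⊖ I))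
    × (v {n} J ≡ numLatin n)
proposition4p8 zero = (λ ()) , v-J≡n!*v-J⊖I 0 , v-J≡numLatin 0
proposition4p8 (suc zero) = (λ { (s≤s ()) }) , v-J≡n!*v-J⊖I 1 , v-J≡numLatin 1
proposition4p8 (suc (suc m)) = (λ _ → ClassSum.classSum m) , v-J≡n!*v-J⊖I (suc (suc m)) , v-J≡numLatin (suc (suc m))
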